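{- Let $G$ be a simple connected graph with edge-connectivity $k$. Then $\sigma^{ - }(G) \geq k$.
   Context: The edge-connectivity of $G$ is the minimum number of edges whose removal disconnects $G$. For a graph $G$ of order $N$, the \textbf{rna} number $\sigma^{ - }(G)$ is the minimum, over all bijections $f: V(G)\to\{1,2,\dots,N\}$, of the number of edges $uv$ of $G$ such that $f(u)$ and $f(v)$ have different parity. -}

module Defs where

open import Data.Nat using (ℕ; zero; suc; _+_; _≤_; _<_; _%_)
open import Data.Bool using (Bool; true; false; _∧_; not; if_then_else_)
open import Data.Fin using (Fin; toℕ)
open import Data.List using (List; map)
open import Data.Nat.ListAction using (sum)
open import Data.List.Base using (allFin)
open import Data.Nat.Base using (_<ᵇ_; _≡ᵇ_)
open import Data.Product using (Σ; _×_; ∃)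
open import Relation.Binary.PropositionalEquality using (_≡_)
open import Relation.Nullary using (¬_)
open import Function.Definitions using (Bijective)

record Graph (n : ℕ) : Set where
  field
    adj    : Fin n → Fin n → Bool
    sym    : ∀ i j → adj i j ≡ adj j i
    irrefl : ∀ i → adj i i ≡ false
open Graph public

data Reachable {n : ℕ} (a : Fin n → Fin n → Bool) : Fin n → Fin n → Set where
  here : ∀ {u} → Reachable a u u
  step : ∀ {u w v} → a u w ≡ true → Reachable a w v → Reachable a u v

ConnectedAdj : {n : ℕ} → (Fin n → Fin n → Bool) → Set
ConnectedAdj {n} a = ∀ (u v : Fin n) → Reachable a u v

Connected : {n : ℕ} → Graph n → Set
Connected G = ConnectedAdj (adj G)

countEdges : {n : ℕ} → (Fin n → Fin n → Bool) → (Fin n → Fin n → Bool) → ℕ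
countEdges {n} a p =
  sum (map (λ i → sum (map (λ j →
        if (toℕ i <ᵇ toℕ j) ∧ a i j ∧ p i j then 1 else 0) (allFin n))) (allFin n))

numEdges : {n : ℕ} → (Fin n → Fin n → Bool) → ℕ
numEdges a = countEdges a (λ _ _ → true)

record EdgeSet {n : ℕ} (G : Graph n) : Set where
  field
    mem    : Fin n → Fin n → Bool
    memSym : ∀ i j → mem i j ≡ mem j i
    sub    : ∀ i j → mem i j ≡ true → adj G i j ≡ true
open EdgeSet public

removeEdges : {n : ℕ} (G : Graph n) → EdgeSet G → Fin n → Fin n → Bool
removeEdges G S i j = adj G i j ∧ not (mem S i j)

Disconnecting : {n : ℕ} (G : Graph n) → EdgeSet G → Set
Disconnecting G S = ¬ ConnectedAdj (removeEdges G S)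

IsEdgeConnectivity : {n : ℕ} → Graph n → ℕ → Set
IsEdgeConnectivity G k =
  (Σ (EdgeSet G) λ S → Disconnecting G S × numEdges (mem S) ≡ k)
  × (∀ (S : EdgeSet G) → Disconnecting G S → k ≤ numEdges (mem S))

-- Label of vertex v under a bijection f : V → {1,…,N} (Fin n encodes 0..n-1).
label : {n : ℕ} → (Fin n → Fin n) → Fin n → ℕ
label f v = suc (toℕ (f v))

differentParity : ℕ → ℕ → Bool
differentParity x y = not ((x % 2) ≡ᵇ (y % 2))

oddEdges : {n : ℕ} → Graph n → (Fin n → Fin n) → ℕ
oddEdges G f = countEdges (adj G) (λ u v → differentParity (label f u) (label f v))

IsRnaNumber : {n : ℕ} → Graph n → ℕ → Set
IsRnaNumber {n} G s =
  (Σ (Fin n → Fin n) λ f → Bijective _≡_ _≡_ f × oddEdges G f ≡ s)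
  × (∀ (f : Fin n → Fin n) → Bijective _≡_ _≡_ f → s ≤ oddEdges G f)

-- Colour every vertex by the parity of its label.  The edges whose endpoints
-- get different colours form an edge set of size σ⁻(G) for an optimal labelling;
-- removing it leaves only monochromatic edges, so every walk of G minus the set
-- stays inside one colour class.  As soon as N ≥ 2 both the labels 1 and 2 occur,
-- so both colour classes are nonempty and the set disconnects G; hence k ≤ σ⁻(G).
-- On at most one vertex no edge set is disconnecting, contradicting the
-- existence of a minimum one.
module Submission where

open import Defs
open import Data.Nat using (ℕ; zero; suc; _≤_; _%_; z≤n; s≤s)
open import Data.Nat.Base using (_≡ᵇ_; _<ᵇ_)
open import Data.Nat.ListAction using (sum)
open import Data.Nat.Properties using (≡ᵇ⇒≡; module ≤-Reasoning)
open import Data.Bool using (Bool; true; false; _∧_; not; if_then_else_; T)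
open import Data.Bool.Properties using (∧-identityʳ)
open import Data.Fin using (Fin; toℕ)
import Data.Fin as Fin
open import Data.List using (map)
open import Data.List.Base using (allFin)
open import Data.List.Properties using (map-cong)
open import Data.Product using (_,_; proj₂)
open import Function.Definitions using (Surjective)
open import Relation.Binary.PropositionalEquality
  using (_≡_; refl; trans; cong; cong₂; subst) renaming (sym to ≡-sym)
open import Relation.Nullary using (¬_)

≡ᵇ-sym : ∀ m n → (m ≡ᵇ n) ≡ (n ≡ᵇ m)
≡ᵇ-sym zero    zero    = refl
≡ᵇ-sym zero    (suc n) = refl
≡ᵇ-sym (suc m) zero    = refl
≡ᵇ-sym (suc m) (suc n) = ≡ᵇ-sym m n

differentParity-sym : ∀ x y → differentParity x y ≡ differentParity y x
differentParity-sym x y = cong not (≡ᵇ-sym (x % 2) (y % 2))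

differentParity≡false⇒%2≡ : ∀ x y → differentParity x y ≡ false → x % 2 ≡ y % 2
differentParity≡false⇒%2≡ x y eq with x % 2 ≡ᵇ y % 2 in same
differentParity≡false⇒%2≡ x y refl | true = ≡ᵇ⇒≡ (x % 2) (y % 2) (subst T (≡-sym same) _)

numEdges-∧ : ∀ {n} (a p : Fin n → Fin n → Bool) →
             numEdges (λ i j → a i j ∧ p i j) ≡ countEdges a p
numEdges-∧ {n} a p =
  cong sum (map-cong (λ i → cong sum (map-cong (λ j →
    cong (λ b → if (toℕ i <ᵇ toℕ j) ∧ b then 1 else 0) (∧-identityʳ (a i j ∧ p i j)))
    (allFin n))) (allFin n))

Reachable-invariant : ∀ {n} {A : Set} {a : Fin n → Fin n → Bool} (P : Fin n → A) →
                      (∀ {u w} → a u w ≡ true → P u ≡ P w) →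
                      ∀ {u v} → Reachable a u v → P u ≡ P v
Reachable-invariant P preserves here           = refl
Reachable-invariant P preserves (step edge walk) =
  trans (preserves edge) (Reachable-invariant P preserves walk)

¬ConnectedAdj⇒2≤n : ∀ {n} {a : Fin n → Fin n → Bool} → ¬ ConnectedAdj a → 2 ≤ n
¬ConnectedAdj⇒2≤n {zero}        disconnected with () ← disconnected (λ ())
¬ConnectedAdj⇒2≤n {suc zero}    disconnected
  with () ← disconnected (λ { Fin.zero Fin.zero → here })
¬ConnectedAdj⇒2≤n {suc (suc n)} disconnected = s≤s (s≤s z≤n)

module _ {n : ℕ} (G : Graph n) (f : Fin n → Fin n) where

  differentParityᶠ : Fin n → Fin n → Bool
  differentParityᶠ u v = differentParity (label f u) (label f v)

  parityCut : EdgeSet G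
  parityCut = record
    { mem    = λ u v → adj G u v ∧ differentParityᶠ u v
    ; memSym = λ u v → cong₂ _∧_ (Graph.sym G u v)
                                 (differentParity-sym (label f u) (label f v))
    ; sub    = λ u v → ∧-true
    }
    where
    ∧-true : ∀ {b c} → b ∧ c ≡ true → b ≡ true
    ∧-true {true} _ = refl

  numEdges-parityCut : numEdges (mem parityCut) ≡ oddEdges G f
  numEdges-parityCut = numEdges-∧ (adj G) differentParityᶠ

  reachable-sameParity : ∀ {u v} → Reachable (removeEdges G parityCut) u v →
                         label f u % 2 ≡ label f v % 2
  reachable-sameParity = Reachable-invariant (λ u → label f u % 2) uncut-sameParity
    where
    uncut⇒¬differentParity : ∀ b c → b ∧ not (b ∧ c) ≡ true → c ≡ false
    uncut⇒¬differentParity true false _ = refl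

    uncut-sameParity : ∀ {u w} → removeEdges G parityCut u w ≡ true →
                       label f u % 2 ≡ label f w % 2
    uncut-sameParity {u} {w} e =
      differentParity≡false⇒%2≡ (label f u) (label f w)
        (uncut⇒¬differentParity (adj G u w) (differentParityᶠ u w) e)

-- The preimages of 0 and 1 carry the labels 1 and 2, of different parity.
parityCut-disconnecting : ∀ {n} (G : Graph n) (f : Fin n → Fin n) →
                          Surjective _≡_ _≡_ f → 2 ≤ n → Disconnecting G (parityCut G f)
parityCut-disconnecting {suc (suc n)} G f surjective (s≤s (s≤s z≤n)) connected
  with surjective Fin.zero | surjective (Fin.suc Fin.zero)
... | u , fu≡0 | v , fv≡1
  with reachable-sameParity G f (connected u v)
... | parity≡ rewrite fu≡0 {u} refl | fv≡1 {v} refl with () ← parity≡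

theorem4p1 : ∀ {n : ℕ} (G : Graph n) (k s : ℕ) →
    Connected G → IsEdgeConnectivity G k → IsRnaNumber G s → k ≤ s
theorem4p1 G k s _ ((_ , disconnecting , _) , minimal) ((f , bijective , oddEdges≡s) , _) =
  begin
    k                               ≤⟨ minimal (parityCut G f) cut-disconnecting ⟩
    numEdges (mem (parityCut G f))  ≡⟨ numEdges-parityCut G f ⟩
    oddEdges G f                    ≡⟨ oddEdges≡s ⟩
    s                               ∎
  where
  open ≤-Reasoning
  cut-disconnecting : Disconnecting G (parityCut G f)
  cut-disconnecting =
    parityCut-disconnecting G f (proj₂ bijective) (¬ConnectedAdj⇒2≤n disconnecting)
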